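{- For every integer $n\ge 1$, $$\sum_{\pi\in \mathcal I^C_{2n}(321)}q^{\mathrm{des}(\pi)}=(1+q)^n.$$
   Context: A permutation $\pi\in\mathcal S_m$ is centrosymmetric if $\pi(i)+\pi(m+1-i)=m+1$ for all $1\le i\le m$. $\mathcal I^C_m(321)$ denotes the set of centrosymmetric involutions in $\mathcal S_m$ that avoid the pattern $321$ (i.e., contain no indices $i<j<k$ with $\pi(i)>\pi(j)>\pi(k)$). $\mathrm{des}(\pi)$ is the number of $i\in[m-1]$ with $\pi(i)>\pi(i+1)$. -}

module Defs where

open import Level using (Level)
open import Data.Nat using (ℕ; zero; suc; _+_; _∸_; _<_; _>_; _<?_)
open import Data.Fin as Fin using (Fin; toℕ; opposite)
open import Data.Fin.Properties using (all?; any?) renaming (_≟_ to _≟ᶠ_)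
open import Data.Nat.Properties using () renaming (_≟_ to _≟ℕ_)
open import Data.Vec using (Vec; []; _∷_; lookup; toList; map)
open import Data.List as List using (List; []; _∷_; [_]; concatMap; filter)
open import Data.Product using (_×_; ∃)
open import Relation.Binary.PropositionalEquality using (_≡_)
open import Relation.Nullary using (¬_; Dec; yes; no)
open import Relation.Nullary.Decidable using (¬?; _×-dec_; _→-dec_)
open import Algebra.Bundles using (CommutativeSemiring)

-- A map [m] → [m] (0-indexed: Fin m), stored as the vector of its values
-- (π(0), …, π(m-1)).
Map : ℕ → Set
Map m = Vec (Fin m) m

-- π is a permutation of [m] (injective endomap of a finite set).
IsPerm : ∀ {m} → Map m → Set
IsPerm {m} π = ∀ (i j : Fin m) → lookup π i ≡ lookup π j → i ≡ j

IsInvolution : ∀ {m} → Map m → Set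
IsInvolution {m} π = ∀ (i : Fin m) → lookup π (lookup π i) ≡ i

-- Centrosymmetric: π(i) + π(m+1-i) = m+1 in 1-indexed form,
-- i.e. π(i) + π(m-1-i) = m-1 in 0-indexed form (opposite i = m-1-i).
IsCentrosymmetric : ∀ {m} → Map m → Set
IsCentrosymmetric {m} π =
  ∀ (i : Fin m) → toℕ (lookup π i) + toℕ (lookup π (opposite i)) ≡ m ∸ 1

Contains321 : ∀ {m} → Map m → Set
Contains321 {m} π =
  ∃ λ (i : Fin m) → ∃ λ (j : Fin m) → ∃ λ (k : Fin m) →
    (toℕ i < toℕ j) × (toℕ j < toℕ k) ×
    (toℕ (lookup π i) > toℕ (lookup π j)) × (toℕ (lookup π j) > toℕ (lookup π k))

Avoids321 : ∀ {m} → Map m → Set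
Avoids321 π = ¬ Contains321 π

InIC321 : ∀ {m} → Map m → Set
InIC321 π = IsPerm π × IsInvolution π × IsCentrosymmetric π × Avoids321 π

isPerm? : ∀ {m} (π : Map m) → Dec (IsPerm π)
isPerm? π = all? λ i → all? λ j → (lookup π i ≟ᶠ lookup π j) →-dec (i ≟ᶠ j)

isInvolution? : ∀ {m} (π : Map m) → Dec (IsInvolution π)
isInvolution? π = all? λ i → lookup π (lookup π i) ≟ᶠ i

isCentrosymmetric? : ∀ {m} (π : Map m) → Dec (IsCentrosymmetric π)
isCentrosymmetric? {m} π =
  all? λ i → (toℕ (lookup π i) + toℕ (lookup π (opposite i))) ≟ℕ (m ∸ 1)

contains321? : ∀ {m} (π : Map m) → Dec (Contains321 π)
contains321? π =
  any? λ i → any? λ j → any? λ k →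
    (toℕ i <? toℕ j) ×-dec (toℕ j <? toℕ k) ×-dec
    (toℕ (lookup π j) <? toℕ (lookup π i)) ×-dec (toℕ (lookup π k) <? toℕ (lookup π j))

inIC321? : ∀ {m} (π : Map m) → Dec (InIC321 π)
inIC321? π = isPerm? π ×-dec isInvolution? π ×-dec isCentrosymmetric? π ×-dec ¬? (contains321? π)

allVecs : (k m : ℕ) → List (Vec (Fin k) m)
allVecs k zero    = [ [] ]
allVecs k (suc m) = concatMap (λ x → List.map (x ∷_) (allVecs k m)) (List.allFin k)

IC321 : (m : ℕ) → List (Map m)
IC321 m = filter inIC321? (allVecs m m)

descentAt : ℕ → ℕ → ℕ
descentAt a b with b <? a
... | yes _ = 1
... | no _  = 0

desFrom : ℕ → List ℕ → ℕ
desFrom a []       = 0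
desFrom a (b ∷ as) = descentAt a b + desFrom b as

desList : List ℕ → ℕ
desList []       = 0
desList (a ∷ as) = desFrom a as

des : ∀ {m} → Map m → ℕ
des π = desList (toList (map toℕ π))

module _ {c ℓ : Level} (R : CommutativeSemiring c ℓ) where
  open CommutativeSemiring R using (Carrier; 0#; rawSemiring) renaming (_+_ to _⊕_)
  open import Algebra.Definitions.RawSemiring rawSemiring using (_^_)

  desGF : (m : ℕ) → Carrier → Carrier
  desGF m q = List.foldr (λ π acc → (q ^ des π) ⊕ acc) 0# (IC321 m)

-- A 321-avoiding involution is determined by its word of arc types (i opens an arc when
-- i < π(i), is fixed, or closes an arc), and it matches the k-th opener with the k-th closer.
-- The words that occur are those in which no prefix has more closers than openers and fixed
-- points sit at level zero.  Centrosymmetry makes the word antisymmetric, so an element of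
-- I^C_{2n}(321) is determined by the first half of its word, which is the path of an arbitrary
-- bit string c ∈ {0,1}ⁿ: 1 is an opener, 0 a closer, or a fixed point at level zero.  The
-- descents of such an involution are exactly the peaks (an opener followed by a closer) of its
-- word, so des = 2·#{i : cᵢcᵢ₊₁ = 10} + cₙ.  Appending a bit to c raises this number by 0 for
-- one choice of the bit and by 1 for the other, hence the sum is (1 + q)ⁿ.
module Submission where

open import Level using (Level)
open import Function using (_∘_)
open import Data.List as List using (List; []; _∷_; concatMap)
import Data.List.Properties as List
open import Data.List.Relation.Binary.Permutation.Propositional using (_↭_; ↭⇒↭ₛ′)
open import Data.List.Relation.Binary.Permutation.Propositional.Properties
  using () renaming (map⁺ to ↭-map⁺)
open import Data.List.Relation.Binary.Permutation.Setoid.Properties using (foldr-commMonoid)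
open import Algebra.Bundles using (CommutativeSemiring)
import Relation.Binary.PropositionalEquality as ≡

module ListSum {c ℓ} (R : CommutativeSemiring c ℓ) where
  open CommutativeSemiring R
  open import Algebra.Properties.CommutativeSemigroup +-commutativeSemigroup using (interchange)

  sumOver : ∀ {a} {A : Set a} → (A → Carrier) → List A → Carrier
  sumOver w xs = List.foldr _+_ 0# (List.map w xs)

  sumOver-↭ : ∀ {a} {A : Set a} (w : A → Carrier) {xs ys} → xs ↭ ys → sumOver w xs ≈ sumOver w ys
  sumOver-↭ w p = foldr-commMonoid setoid +-isCommutativeMonoid (↭⇒↭ₛ′ isEquivalence (↭-map⁺ w p))

  sumOver-map : ∀ {a b} {A : Set a} {B : Set b} (w : B → Carrier) (f : A → B) xs →
              sumOver w (List.map f xs) ≡.≡ sumOver (w ∘ f) xs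
  sumOver-map w f xs = ≡.cong (List.foldr _+_ 0#) (≡.sym (List.map-∘ xs))

  sumOver-cong : ∀ {a} {A : Set a} {w w′ : A → Carrier} → (∀ x → w x ≈ w′ x) →
               ∀ xs → sumOver w xs ≈ sumOver w′ xs
  sumOver-cong w≈w′ []       = refl
  sumOver-cong w≈w′ (x ∷ xs) = +-cong (w≈w′ x) (sumOver-cong w≈w′ xs)

  sumOver-++ : ∀ {a} {A : Set a} (w : A → Carrier) xs ys →
             sumOver w (xs List.++ ys) ≈ sumOver w xs + sumOver w ys
  sumOver-++ w []       ys = sym (+-identityˡ _)
  sumOver-++ w (x ∷ xs) ys = trans (+-congˡ (sumOver-++ w xs ys)) (sym (+-assoc _ _ _))

  sumOver-concatMap : ∀ {a b} {A : Set a} {B : Set b} (w : B → Carrier) (f : A → List B) xs →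
                    sumOver w (concatMap f xs) ≈ sumOver (sumOver w ∘ f) xs
  sumOver-concatMap w f []       = refl
  sumOver-concatMap w f (x ∷ xs) =
    trans (sumOver-++ w (f x) (concatMap f xs)) (+-congˡ (sumOver-concatMap w f xs))

  sumOver-+ : ∀ {a} {A : Set a} (u v : A → Carrier) xs →
            sumOver u xs + sumOver v xs ≈ sumOver (λ x → u x + v x) xs
  sumOver-+ u v []       = +-identityˡ 0#
  sumOver-+ u v (x ∷ xs) = trans (interchange (u x) _ (v x) _) (+-congˡ (sumOver-+ u v xs))

  sumOver-*ˡ : ∀ {a} {A : Set a} k (w : A → Carrier) xs → sumOver (λ x → k * w x) xs ≈ k * sumOver w xs
  sumOver-*ˡ k w []       = sym (zeroʳ k)
  sumOver-*ˡ k w (x ∷ xs) = trans (+-congˡ (sumOver-*ˡ k w xs)) (sym (distribˡ k _ _))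

open import Defs
open import Function using (Equivalence; mk⇔)
open import Data.Empty using (⊥; ⊥-elim)
open import Data.Bool using (Bool; true; false; if_then_else_; not; _∧_)
open import Data.Bool.Properties using (T-≡; ∧-conicalˡ; ∧-conicalʳ)
open import Data.Nat hiding (_^_)
open import Data.Nat.Properties
open import Data.Nat.Induction using (<-rec)
open import Data.Nat.Tactic.RingSolver using (solve-∀)
open import Algebra.Properties.CommutativeSemigroup +-commutativeSemigroup
  using (xy∙z≈xz∙y) renaming (interchange to +-interchange)
open import Data.Fin as Fin using (Fin; toℕ; fromℕ<; opposite)
open import Data.Fin.Properties using (toℕ-fromℕ<; toℕ<n; toℕ-injective; opposite-prop)
open import Data.Vec as Vec using (Vec; []; _∷_; lookup; toList; tabulate)
open import Data.Vec.Properties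
  using (∷-injectiveˡ; ∷-injectiveʳ; length-toList; lookup∘tabulate; tabulate∘lookup; tabulate-cong)
open import Data.List using ([_])
open import Data.List.Membership.Propositional using (_∈_)
open import Data.List.Membership.Propositional.Properties
  using (∈-map⁺; ∈-map⁻; ∈-concat⁺′; ∈-allFin; ∈-filter⁺; ∈-filter⁻)
open import Data.List.Membership.Propositional.Properties.WithK using (unique∧set⇒bag)
open import Data.List.Relation.Binary.BagAndSetEquality using (∼bag⇒↭)
open import Data.List.Relation.Binary.Disjoint.Propositional using (Disjoint)
open import Data.List.Relation.Unary.Any using (here; there)
import Data.List.Relation.Unary.All as All
open import Data.List.Relation.Unary.All.Properties using () renaming (map⁺ to All-map⁺)
open import Data.List.Relation.Unary.AllPairs as AllPairs using ([]; _∷_)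
open import Data.List.Relation.Unary.AllPairs.Properties using () renaming (map⁺ to AllPairs-map⁺)
open import Data.List.Relation.Unary.Unique.Propositional using (Unique)
open import Data.List.Relation.Unary.Unique.Propositional.Properties
  using (concat⁺) renaming (map⁺ to Unique-map⁺; filter⁺ to Unique-filter⁺; allFin⁺ to Unique-allFin⁺)
open import Data.Product using (∃; _×_; _,_; proj₁; proj₂)
open import Data.Sum using (inj₁; inj₂)
open import Relation.Binary.Definitions using (tri<; tri≈; tri>)
open import Relation.Binary.PropositionalEquality
  using (_≡_; _≢_; refl; sym; trans; cong; cong₂; subst; subst₂; ≢-sym; module ≡-Reasoning)
open import Relation.Nullary using (¬_; yes; no)
open import Relation.Nullary.Decidable using (dec-true; dec-false)

<ᵇ-true : ∀ {a b} → a < b → (a <ᵇ b) ≡ true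
<ᵇ-true {a} {b} = dec-true (a <? b)

<ᵇ-false : ∀ {a b} → ¬ a < b → (a <ᵇ b) ≡ false
<ᵇ-false {a} {b} = dec-false (a <? b)

≤ᵇ-true : ∀ {a b} → a ≤ b → (a ≤ᵇ b) ≡ true
≤ᵇ-true {a} {b} = dec-true (a ≤? b)

≤ᵇ-false : ∀ {a b} → ¬ a ≤ b → (a ≤ᵇ b) ≡ false
≤ᵇ-false {a} {b} = dec-false (a ≤? b)

≤ᵇ-true⁻¹ : ∀ {a b} → (a ≤ᵇ b) ≡ true → a ≤ b
≤ᵇ-true⁻¹ {a} {b} e = ≤ᵇ⇒≤ a b (Equivalence.from T-≡ e)

≡ᵇ-true : ∀ {a b} → a ≡ b → (a ≡ᵇ b) ≡ true
≡ᵇ-true {a} {b} = dec-true (a ≟ b)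

≡ᵇ-false : ∀ {a b} → a ≢ b → (a ≡ᵇ b) ≡ false
≡ᵇ-false {a} {b} = dec-false (a ≟ b)

≡ᵇ-true⁻¹ : ∀ {a b} → (a ≡ᵇ b) ≡ true → a ≡ b
≡ᵇ-true⁻¹ {a} {b} e = ≡ᵇ⇒≡ a b (Equivalence.from T-≡ e)

iverson : Bool → ℕ
iverson true  = 1
iverson false = 0

count : (ℕ → Bool) → ℕ → ℕ
count P zero    = 0
count P (suc k) = count P k + iverson (P k)

module _ (P : ℕ → Bool) where

  count-suc-true : ∀ {k} → P k ≡ true → count P (suc k) ≡ suc (count P k)
  count-suc-true {k} e rewrite e = +-comm (count P k) 1

  count-suc-false : ∀ {k} → P k ≡ false → count P (suc k) ≡ count P k
  count-suc-false {k} e rewrite e = +-identityʳ (count P k)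

  count-mono : ∀ {a b} → a ≤ b → count P a ≤ count P b
  count-mono {b = zero} z≤n = ≤-refl
  count-mono {a} {suc b} a≤1+b with m≤n⇒m<n∨m≡n a≤1+b
  ... | inj₁ (s≤s a≤b) = ≤-trans (count-mono a≤b) (m≤m+n (count P b) _)
  ... | inj₂ refl      = ≤-refl

  count-strict : ∀ {a b} → a < b → P a ≡ true → count P a < count P b
  count-strict a<b e = ≤-trans (≤-reflexive (sym (count-suc-true e))) (count-mono a<b)

  count-<⇒< : ∀ {a b} → count P a < count P b → a < b
  count-<⇒< {a} {b} lt with a <? b
  ... | yes a<b = a<b
  ... | no a≮b  = ⊥-elim (<⇒≱ lt (count-mono (≮⇒≥ a≮b)))

  count-injective : ∀ {a b} → P a ≡ true → P b ≡ true → count P a ≡ count P b → a ≡ b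
  count-injective {a} {b} pa pb e with <-cmp a b
  ... | tri< a<b _ _ = ⊥-elim (<-irrefl e (count-strict a<b pa))
  ... | tri≈ _ a≡b _ = a≡b
  ... | tri> _ _ b<a = ⊥-elim (<-irrefl (sym e) (count-strict b<a pb))

  count-positive : ∀ {k} → 0 < count P k → ∃ λ j → j < k × P j ≡ true
  count-positive {suc k} pos with P k in e
  ... | true  = k , ≤-refl , e
  ... | false with count-positive (subst (0 <_) (+-identityʳ (count P k)) pos)
  ...   | j , j<k , pj = j , m<n⇒m<1+n j<k , pj

  -- Discrete intermediate value theorem: count P climbs in unit steps at the points of P.
  count-attains : ∀ {v k} → v < count P k → ∃ λ j → j < k × P j ≡ true × count P j ≡ v
  count-attains {v} {suc k} lt with v <? count P k | P k in e
  ... | yes v<c | _ with count-attains v<c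
  ...   | j , j<k , pj , cj = j , m<n⇒m<1+n j<k , pj , cj
  count-attains {v} {suc k} lt | no v≮c | true =
    k , ≤-refl , e , ≤-antisym (≮⇒≥ v≮c) (s≤s⁻¹ (subst (v <_) (+-comm (count P k) 1) lt))
  count-attains {v} {suc k} lt | no v≮c | false =
    ⊥-elim (v≮c (subst (v <_) (+-identityʳ (count P k)) lt))

  count-front : ∀ k → count P (suc k) ≡ iverson (P 0) + count (P ∘ suc) k
  count-front zero    = +-comm 0 (iverson (P 0))
  count-front (suc k) = begin
    count P (suc k) + iverson (P (suc k))                   ≡⟨ cong (_+ iverson (P (suc k))) (count-front k) ⟩
    iverson (P 0) + count (P ∘ suc) k + iverson (P (suc k)) ≡⟨ +-assoc (iverson (P 0)) _ _ ⟩
    iverson (P 0) + count (P ∘ suc) (suc k)                 ∎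
    where open ≡-Reasoning

  count-split : ∀ a b → count P (a + b) ≡ count P a + count (λ x → P (a + x)) b
  count-split a zero    = trans (cong (count P) (+-identityʳ a)) (sym (+-identityʳ _))
  count-split a (suc b) = begin
    count P (a + suc b)                                         ≡⟨ cong (count P) (+-suc a b) ⟩
    count P (a + b) + iverson (P (a + b))                       ≡⟨ cong (_+ iverson (P (a + b))) (count-split a b) ⟩
    count P a + count (λ x → P (a + x)) b + iverson (P (a + b)) ≡⟨ +-assoc (count P a) _ _ ⟩
    count P a + count (λ x → P (a + x)) (suc b)                 ∎
    where open ≡-Reasoning

count-cong : ∀ P Q k → (∀ i → i < k → P i ≡ Q i) → count P k ≡ count Q k
count-cong P Q zero    h = refl
count-cong P Q (suc k) h =
  cong₂ _+_ (count-cong P Q k (λ i i<k → h i (m<n⇒m<1+n i<k))) (cong iverson (h k ≤-refl))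

count-reverse : ∀ P k → count P k ≡ count (λ x → P (k ∸ suc x)) k
count-reverse P zero    = refl
count-reverse P (suc k) = begin
  count P k + iverson (P k)                          ≡⟨ +-comm (count P k) _ ⟩
  iverson (P k) + count P k                          ≡⟨ cong (iverson (P k) +_) (count-reverse P k) ⟩
  iverson (P k) + count (λ x → P (k ∸ suc x)) k      ≡⟨ count-front (λ x → P (suc k ∸ suc x)) k ⟨
  count (λ x → P (suc k ∸ suc x)) (suc k)            ∎
  where open ≡-Reasoning

count-+ : ∀ P Q S k → (∀ i → i < k → iverson (P i) ≡ iverson (Q i) + iverson (S i)) →
          count P k ≡ count Q k + count S k
count-+ P Q S zero    h = refl
count-+ P Q S (suc k) h = begin
  count P k + iverson (P k)
    ≡⟨ cong₂ _+_ (count-+ P Q S k (λ i i<k → h i (m<n⇒m<1+n i<k))) (h k ≤-refl) ⟩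
  count Q k + count S k + (iverson (Q k) + iverson (S k))
    ≡⟨ +-interchange (count Q k) _ _ _ ⟩
  count Q k + iverson (Q k) + (count S k + iverson (S k))
    ∎
  where open ≡-Reasoning

count-≡ᵇ : ∀ c k → count (_≡ᵇ c) k ≡ iverson (c <ᵇ k)
count-≡ᵇ c zero = refl
count-≡ᵇ c (suc k) rewrite count-≡ᵇ c k with <-cmp k c
... | tri< k<c _ _
  rewrite <ᵇ-false (<⇒≯ k<c) | ≡ᵇ-false (<⇒≢ k<c) | <ᵇ-false {c} {suc k} (<⇒≱ (s≤s k<c)) = refl
... | tri≈ _ refl _
  rewrite <ᵇ-false (n≮n k) | ≡ᵇ-true (refl {x = k}) | <ᵇ-true (n<1+n k) = refl
... | tri> _ _ c<k
  rewrite <ᵇ-true c<k | ≡ᵇ-false (≢-sym (<⇒≢ c<k)) | <ᵇ-true (m<n⇒m<1+n c<k) = refl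

-- least P k is the least j < k with P j, and at least k if there is none.
least : (ℕ → Bool) → ℕ → ℕ
least P zero = 0
least P (suc k) with least P k <? k
... | yes _ = least P k
... | no _  = if P k then k else suc k

least-satisfies : ∀ P k → least P k < k → P (least P k) ≡ true
least-satisfies P (suc k) lt with least P k <? k
... | yes l<k = least-satisfies P k l<k
... | no _ with P k in pk
...   | true  = pk
...   | false = ⊥-elim (n≮n (suc k) lt)

least-< : ∀ P {k j} → j < k → P j ≡ true → least P k < k
least-< P {suc k} j<1+k pj with least P k <? k
... | yes l<k = m<n⇒m<1+n l<k
... | no l≮k with m≤n⇒m<n∨m≡n (s≤s⁻¹ j<1+k)
...   | inj₁ j<k  = ⊥-elim (l≮k (least-< P j<k pj))
...   | inj₂ refl rewrite pj = ≤-refl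

-- Arc types of 321-avoiding involutions

data ArcType : Set where
  opener fixed closer : ArcType

arcType : ℕ → ℕ → ArcType
arcType i j with <-cmp i j
... | tri< _ _ _ = opener
... | tri≈ _ _ _ = fixed
... | tri> _ _ _ = closer

arcType-opener : ∀ {i j} → i < j → arcType i j ≡ opener
arcType-opener {i} {j} i<j with <-cmp i j
... | tri< _ _ _   = refl
... | tri≈ i≮j _ _ = ⊥-elim (i≮j i<j)
... | tri> i≮j _ _ = ⊥-elim (i≮j i<j)

arcType-fixed : ∀ {i j} → i ≡ j → arcType i j ≡ fixed
arcType-fixed {i} {j} i≡j with <-cmp i j
... | tri< _ i≢j _ = ⊥-elim (i≢j i≡j)
... | tri≈ _ _ _   = refl
... | tri> _ i≢j _ = ⊥-elim (i≢j i≡j)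

arcType-closer : ∀ {i j} → j < i → arcType i j ≡ closer
arcType-closer {i} {j} j<i with <-cmp i j
... | tri< _ _ j≮i = ⊥-elim (j≮i j<i)
... | tri≈ _ _ j≮i = ⊥-elim (j≮i j<i)
... | tri> _ _ _   = refl

arcType-opener⁻¹ : ∀ {i j} → arcType i j ≡ opener → i < j
arcType-opener⁻¹ {i} {j} e with <-cmp i j
... | tri< i<j _ _ = i<j

arcType-fixed⁻¹ : ∀ {i j} → arcType i j ≡ fixed → i ≡ j
arcType-fixed⁻¹ {i} {j} e with <-cmp i j
... | tri≈ _ i≡j _ = i≡j

arcType-closer⁻¹ : ∀ {i j} → arcType i j ≡ closer → j < i
arcType-closer⁻¹ {i} {j} e with <-cmp i j
... | tri> _ _ j<i = j<i

mirror : ArcType → ArcType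
mirror opener = closer
mirror fixed  = fixed
mirror closer = opener

mirror-involutive : ∀ t → mirror (mirror t) ≡ t
mirror-involutive opener = refl
mirror-involutive fixed  = refl
mirror-involutive closer = refl

mirror-fixed : ∀ {t} → mirror t ≡ fixed → t ≡ fixed
mirror-fixed {fixed} _ = refl

complement-< : ∀ {m} i j → suc (i + j) ≡ m → i < m
complement-< i j e = subst (i <_) e (s≤s (m≤m+n i j))

complement-sym : ∀ {m} i j → suc (i + j) ≡ m → suc (j + i) ≡ m
complement-sym i j e = trans (cong suc (+-comm j i)) e

sum-balance : ∀ {i j a b} → i + j ≡ a + b → i < a → b < j
sum-balance {i} {j} {a} {b} e i<a with b <? j
... | yes b<j = b<j
... | no b≮j  = ⊥-elim (<-irrefl e (+-mono-<-≤ i<a (≮⇒≥ b≮j)))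

arcType-reflect : ∀ {m i j a b} → suc (i + j) ≡ m → suc (a + b) ≡ m → arcType i a ≡ mirror (arcType j b)
arcType-reflect {i = i} {j} {a} {b} ij ab with suc-injective (trans ij (sym ab)) | <-cmp i a
... | i+j≡a+b | tri< i<a _ _  = sym (cong mirror (arcType-closer (sum-balance i+j≡a+b i<a)))
... | i+j≡a+b | tri≈ _ refl _ = sym (cong mirror (arcType-fixed (+-cancelˡ-≡ i j b i+j≡a+b)))
... | i+j≡a+b | tri> _ _ a<i  = sym (cong mirror (arcType-opener (sum-balance (sym i+j≡a+b) a<i)))

record Is321AvoidingInvolution (m : ℕ) (f : ℕ → ℕ) : Set where
  field
    bounded    : ∀ {i} → i < m → f i < m
    involutive : ∀ {i} → i < m → f (f i) ≡ i
    avoids321  : ∀ {a b c} → a < b → b < c → c < m → f b < f a → f c < f b → ⊥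

  injective : ∀ {i j} → i < m → j < m → f i ≡ f j → i ≡ j
  injective i<m j<m e = trans (sym (involutive i<m)) (trans (cong f e) (involutive j<m))

  -- A descent at i forces i to open an arc and i + 1 to close one: otherwise a 321 appears.
  descent-opener-closer : ∀ {i} → suc i < m → f (suc i) < f i → i < f i × f (suc i) < suc i
  descent-opener-closer {i} 1+i<m d = i<fi , fsi<si
    where
    i<m = <-trans (n<1+n i) 1+i<m
    i<fi : i < f i
    i<fi with i <? f i
    ... | yes i<fi = i<fi
    ... | no i≮fi  = ⊥-elim (avoids321 (<-≤-trans d fi≤i) (n<1+n i) 1+i<m
                               (subst (f i <_) (sym (involutive 1+i<m)) (s≤s fi≤i)) d)
      where fi≤i = ≮⇒≥ i≮fi
    fsi<si : f (suc i) < suc i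
    fsi<si with f (suc i) <? suc i
    ... | yes lt = lt
    ... | no fsi≮si with m≤n⇒m<n∨m≡n (≮⇒≥ fsi≮si)
    ...   | inj₁ si<fsi = ⊥-elim (avoids321 (n<1+n i) si<fsi (bounded 1+i<m) d
                                   (subst (_< f (suc i)) (sym (involutive 1+i<m)) si<fsi))
    ...   | inj₂ si≡fsi = ⊥-elim (avoids321 (n<1+n i) (subst (_< f i) (sym si≡fsi) d) (bounded i<m) d
                                   (subst (f (f i) <_) si≡fsi (subst (_< suc i) (sym (involutive i<m)) (n<1+n i))))

IsCentrosymmetricOn : ℕ → (ℕ → ℕ) → Set
IsCentrosymmetricOn m f = ∀ i j → suc (i + j) ≡ m → suc (f i + f j) ≡ m

module SameArcTypes {m f g} (F : Is321AvoidingInvolution m f) (G : Is321AvoidingInvolution m g)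
                    (same : ∀ {i} → i < m → arcType i (f i) ≡ arcType i (g i)) where
  open Is321AvoidingInvolution

  -- With a = f k and c = g a we get k < c < a, and g k > a > c is a 321 in g.
  opener-image-≤ : ∀ {k} → k < m → (∀ {i} → i < k → f i ≡ g i) → k < f k → ¬ f k < g k
  opener-image-≤ {k} k<m agree k<a a<gk =
    avoids321 G k<c c<a a<m (subst (_< g k) (sym gc≡a) a<gk) (subst (c <_) (sym gc≡a) c<a)
    where
    a = f k
    a<m = bounded F k<m
    c = g a
    gc≡a : g c ≡ a
    gc≡a = involutive G a<m
    c<a : c < a
    c<a = arcType-closer⁻¹ (trans (sym (same a<m)) (arcType-closer (subst (_< a) (sym (involutive F k<m)) k<a)))
    k<c : k < c
    k<c with <-cmp k c
    ... | tri< k<c _ _  = k<c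
    ... | tri≈ _ k≡c _ = ⊥-elim (<-irrefl (sym (trans (cong g k≡c) gc≡a)) a<gk)
    ... | tri> _ _ c<k  = ⊥-elim (<-irrefl (injective F (<-trans c<k k<m) k<m (trans (agree c<k) gc≡a)) c<k)

module _ {m f g} (F : Is321AvoidingInvolution m f) (G : Is321AvoidingInvolution m g) where
  open Is321AvoidingInvolution

  arcTypes-injective : (∀ {i} → i < m → arcType i (f i) ≡ arcType i (g i)) →
                       ∀ {i} → i < m → f i ≡ g i
  arcTypes-injective same {i} = <-rec (λ k → k < m → f k ≡ g k)
    (λ k rec k<m → step k<m (λ i<k → rec i<k (<-trans i<k k<m))) i
    where
    open SameArcTypes F G same using () renaming (opener-image-≤ to f≤g)
    open SameArcTypes G F (sym ∘ same) using () renaming (opener-image-≤ to g≤f)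
    step : ∀ {k} → k < m → (∀ {i} → i < k → f i ≡ g i) → f k ≡ g k
    step {k} k<m agree with <-cmp k (f k)
    ... | tri≈ _ k≡fk _ = trans (sym k≡fk) (arcType-fixed⁻¹ (trans (sym (same k<m)) (arcType-fixed k≡fk)))
    ... | tri> _ _ fk<k = trans (sym (involutive G fk<m)) (cong g gfk≡k)
      where
      fk<m = bounded F k<m
      gfk≡k : g (f k) ≡ k
      gfk≡k = trans (sym (agree fk<k)) (involutive F k<m)
    ... | tri< k<fk _ _ with <-cmp (f k) (g k)
    ...   | tri< fk<gk _ _ = ⊥-elim (f≤g k<m agree k<fk fk<gk)
    ...   | tri≈ _ fk≡gk _ = fk≡gk
    ...   | tri> _ _ gk<fk = ⊥-elim (g≤f k<m (sym ∘ agree) k<gk gk<fk)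
      where k<gk = arcType-opener⁻¹ (trans (sym (same k<m)) (arcType-opener k<fk))

-- Paths of bit sequences

-- A bit sequence β is read as a path: bit 1 is an up step (an opener), bit 0 a down step
-- (a closer) or, at height 0, a flat step (a fixed point).
height : (ℕ → Bool) → ℕ → ℕ
height β zero    = 0
height β (suc i) = if β i then suc (height β i) else pred (height β i)

stepType : Bool → ℕ → ArcType
stepType true  _       = opener
stepType false zero    = fixed
stepType false (suc _) = closer

height-up : ∀ β {k} → β k ≡ true → height β (suc k) ≡ suc (height β k)
height-up β e rewrite e = refl

height-down : ∀ β {k} → β k ≡ false → height β (suc k) ≡ pred (height β k)
height-down β e rewrite e = refl

pathType : (ℕ → Bool) → ℕ → ArcType
pathType β i = stepType (β i) (height β i)

height-cong : ∀ β β' k → (∀ i → i < k → β i ≡ β' i) → height β k ≡ height β' k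
height-cong β β' zero    h = refl
height-cong β β' (suc k) h =
  cong₂ (λ b x → if b then suc x else pred x) (h k ≤-refl)
        (height-cong β β' k (λ i i<k → h i (m<n⇒m<1+n i<k)))

openerBits : (ℕ → ℕ) → ℕ → Bool
openerBits f k = k <ᵇ f k

-- The path of openerBits f is the path traced by the arcs of f.
module OpenArcs {m f} (F : Is321AvoidingInvolution m f) where
  open Is321AvoidingInvolution F

  -- the arcs over the gap just before k
  openArcs : ℕ → ℕ
  openArcs k = count (λ a → k ≤ᵇ f a) k

  openArcs-step : ∀ {k} → k < m → openArcs (suc k) + iverson (f k <ᵇ k) ≡ openArcs k + iverson (k <ᵇ f k)
  openArcs-step {k} k<m = begin
    passing + iverson (k <ᵇ f k) + iverson (f k <ᵇ k)
      ≡⟨ xy∙z≈xz∙y passing _ _ ⟩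
    passing + iverson (f k <ᵇ k) + iverson (k <ᵇ f k)
      ≡⟨ cong (λ z → passing + z + iverson (k <ᵇ f k)) ending ⟨
    passing + count (λ a → f a ≡ᵇ k) k + iverson (k <ᵇ f k)
      ≡⟨ cong (_+ iverson (k <ᵇ f k)) split ⟨
    openArcs k + iverson (k <ᵇ f k)
      ∎
    where
    open ≡-Reasoning
    passing : ℕ
    passing = count (λ a → suc k ≤ᵇ f a) k
    split : openArcs k ≡ passing + count (λ a → f a ≡ᵇ k) k
    split = count-+ _ _ _ k pointwise
      where
      pointwise : ∀ a → a < k → iverson (k ≤ᵇ f a) ≡ iverson (suc k ≤ᵇ f a) + iverson (f a ≡ᵇ k)
      pointwise a _ with <-cmp (f a) k
      ... | tri< fa<k _ _
        rewrite ≤ᵇ-false (<⇒≱ fa<k) | ≤ᵇ-false {suc k} (<⇒≱ (m<n⇒m<1+n fa<k)) | ≡ᵇ-false (<⇒≢ fa<k) = refl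
      ... | tri≈ _ refl _
        rewrite ≤ᵇ-true (≤-refl {f a}) | ≤ᵇ-false (n≮n (f a)) | ≡ᵇ-true (refl {x = f a}) = refl
      ... | tri> _ _ k<fa
        rewrite ≤ᵇ-true (<⇒≤ k<fa) | ≤ᵇ-true k<fa | ≡ᵇ-false (≢-sym (<⇒≢ k<fa)) = refl
    ending : count (λ a → f a ≡ᵇ k) k ≡ iverson (f k <ᵇ k)
    ending = trans (count-cong _ _ k (λ a a<k → partner a (<-trans a<k k<m))) (count-≡ᵇ (f k) k)
      where
      partner : ∀ a → a < m → (f a ≡ᵇ k) ≡ (a ≡ᵇ f k)
      partner a a<m with f a ≟ k
      ... | yes fa≡k rewrite ≡ᵇ-true fa≡k =
        sym (≡ᵇ-true (trans (sym (involutive a<m)) (cong f fa≡k)))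
      ... | no fa≢k rewrite ≡ᵇ-false fa≢k =
        sym (≡ᵇ-false (λ a≡fk → fa≢k (trans (cong f a≡fk) (involutive k<m))))

  -- An arc over a fixed point k would give a 321.
  openArcs-fixed : ∀ {k} → k < m → f k ≡ k → openArcs k ≡ 0
  openArcs-fixed {k} k<m fk≡k with openArcs k in e
  ... | zero  = refl
  ... | suc _ with count-positive (λ a → k ≤ᵇ f a) (subst (0 <_) (sym e) z<s)
  ...   | a , a<k , k≤fa = ⊥-elim (avoids321 a<k k<fa (bounded a<m) fk<fa ffa<fk)
    where
    a<m = <-trans a<k k<m
    k<fa : k < f a
    k<fa = ≤∧≢⇒< (≤ᵇ-true⁻¹ k≤fa) (λ k≡fa → <-irrefl (sym (injective k<m a<m (trans fk≡k k≡fa))) a<k)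
    fk<fa : f k < f a
    fk<fa = subst (_< f a) (sym fk≡k) k<fa
    ffa<fk : f (f a) < f k
    ffa<fk = subst (_< f k) (sym (involutive a<m)) (subst (a <_) (sym fk≡k) a<k)

  openArcs-opener : ∀ {k} → k < m → k < f k → openArcs (suc k) ≡ suc (openArcs k)
  openArcs-opener {k} k<m k<fk with openArcs-step k<m
  ... | step rewrite <ᵇ-false (<⇒≯ k<fk) | <ᵇ-true k<fk = trans (sym (+-identityʳ _)) (trans step (+-comm _ 1))

  openArcs-stay : ∀ {k} → k < m → f k ≡ k → openArcs (suc k) ≡ openArcs k
  openArcs-stay {k} k<m fk≡k with openArcs-step k<m
  ... | step rewrite fk≡k | <ᵇ-false (n≮n k) = trans (sym (+-identityʳ _)) (trans step (+-identityʳ _))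

  openArcs-closer : ∀ {k} → k < m → f k < k → openArcs k ≡ suc (openArcs (suc k))
  openArcs-closer {k} k<m fk<k with openArcs-step k<m
  ... | step rewrite <ᵇ-true fk<k | <ᵇ-false (<⇒≯ fk<k) =
    trans (sym (+-identityʳ _)) (trans (sym step) (+-comm _ 1))

  βf : ℕ → Bool
  βf = openerBits f

  height≡openArcs : ∀ {k} → k ≤ m → height βf k ≡ openArcs k
  height≡openArcs {zero}  _     = refl
  height≡openArcs {suc k} k<m with <-cmp k (f k) | height≡openArcs {k} (<⇒≤ k<m)
  ... | tri< k<fk _ _ | ih = begin
    height βf (suc k)  ≡⟨ height-up βf (<ᵇ-true k<fk) ⟩
    suc (height βf k)  ≡⟨ cong suc ih ⟩
    suc (openArcs k)   ≡⟨ openArcs-opener k<m k<fk ⟨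
    openArcs (suc k)   ∎
    where open ≡-Reasoning
  ... | tri≈ _ k≡fk _ | ih = begin
    height βf (suc k)  ≡⟨ height-down βf (<ᵇ-false (<-irrefl k≡fk)) ⟩
    pred (height βf k) ≡⟨ cong pred (trans ih empty) ⟩
    0                  ≡⟨ trans (openArcs-stay k<m (sym k≡fk)) empty ⟨
    openArcs (suc k)   ∎
    where
    open ≡-Reasoning
    empty : openArcs k ≡ 0
    empty = openArcs-fixed k<m (sym k≡fk)
  ... | tri> _ _ fk<k | ih = begin
    height βf (suc k)  ≡⟨ height-down βf (<ᵇ-false (<⇒≯ fk<k)) ⟩
    pred (height βf k) ≡⟨ cong pred (trans ih (openArcs-closer k<m fk<k)) ⟩
    openArcs (suc k)   ∎
    where open ≡-Reasoning

  pathType≡arcType : ∀ {k} → k < m → pathType βf k ≡ arcType k (f k)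
  pathType≡arcType {k} k<m with <-cmp k (f k)
  ... | tri< k<fk _ _ rewrite <ᵇ-true k<fk = refl
  ... | tri≈ _ k≡fk _
    rewrite <ᵇ-false (<-irrefl k≡fk) | height≡openArcs (<⇒≤ k<m) | openArcs-fixed k<m (sym k≡fk) = refl
  ... | tri> _ _ fk<k
    rewrite <ᵇ-false (<⇒≯ fk<k) | height≡openArcs (<⇒≤ k<m) | openArcs-closer k<m fk<k = refl

-- Words of arc types

isOpener : ArcType → Bool
isOpener opener = true
isOpener fixed  = false
isOpener closer = false

isCloser : ArcType → Bool
isCloser opener = false
isCloser fixed  = false
isCloser closer = true

isOpener-mirror : ∀ t → isOpener (mirror t) ≡ isCloser t
isOpener-mirror opener = refl
isOpener-mirror fixed  = refl
isOpener-mirror closer = refl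

isCloser-mirror : ∀ t → isCloser (mirror t) ≡ isOpener t
isCloser-mirror opener = refl
isCloser-mirror fixed  = refl
isCloser-mirror closer = refl

isOpener⁻¹ : ∀ {t} → isOpener t ≡ true → t ≡ opener
isOpener⁻¹ {opener} _ = refl

isCloser⁻¹ : ∀ {t} → isCloser t ≡ true → t ≡ closer
isCloser⁻¹ {closer} _ = refl

arcType-cases : ∀ {p} {P : Set p} t → (t ≡ opener → P) → (t ≡ fixed → P) → (t ≡ closer → P) → P
arcType-cases opener o _ _ = o refl
arcType-cases fixed  _ x _ = x refl
arcType-cases closer _ _ c = c refl

openers closers : (ℕ → ArcType) → ℕ → ℕ
openers W = count (isOpener ∘ W)
closers W = count (isCloser ∘ W)

IsAntisymmetric : ℕ → (ℕ → ArcType) → Set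
IsAntisymmetric m W = ∀ i j → suc (i + j) ≡ m → W j ≡ mirror (W i)

reflected-position : ∀ {t k} x → t < k → suc (t + (x + (k ∸ suc t))) ≡ x + k
reflected-position {t} {k} x t<k = trans (rearrange t x (k ∸ suc t)) (cong (x +_) (m∸n+n≡m t<k))
  where rearrange : ∀ t x d → suc (t + (x + d)) ≡ x + (d + suc t)
        rearrange = solve-∀

module _ {m W} (antisym : IsAntisymmetric m W) where

  -- Read backwards, the letters of an antisymmetric word after position x are the mirrored first k letters.
  count-antisymmetric : ∀ P Q → (∀ t → P (mirror t) ≡ Q t) → ∀ x k → x + k ≡ m →
                        count (P ∘ W) m ≡ count (P ∘ W) x + count (Q ∘ W) k
  count-antisymmetric P Q PQ x k x+k≡m = begin
    count (P ∘ W) m                                           ≡⟨ cong (count (P ∘ W)) x+k≡m ⟨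
    count (P ∘ W) (x + k)                                     ≡⟨ count-split (P ∘ W) x k ⟩
    count (P ∘ W) x + count (λ t → P (W (x + t))) k           ≡⟨ cong (count (P ∘ W) x +_) (count-reverse _ k) ⟩
    count (P ∘ W) x + count (λ t → P (W (x + (k ∸ suc t)))) k ≡⟨ cong (count (P ∘ W) x +_) (count-cong _ _ k reflected) ⟩
    count (P ∘ W) x + count (Q ∘ W) k                         ∎
    where
    open ≡-Reasoning
    reflected : ∀ t → t < k → P (W (x + (k ∸ suc t))) ≡ Q (W t)
    reflected t t<k = trans (cong P (antisym t _ (trans (reflected-position x t<k) x+k≡m))) (PQ (W t))

  openers-antisymmetric : ∀ x k → x + k ≡ m → openers W m ≡ openers W x + closers W k
  openers-antisymmetric = count-antisymmetric isOpener isCloser isOpener-mirror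

  closers-antisymmetric : ∀ x k → x + k ≡ m → closers W m ≡ closers W x + openers W k
  closers-antisymmetric = count-antisymmetric isCloser isOpener isCloser-mirror

record IsInvolutionWord (m : ℕ) (W : ℕ → ArcType) : Set where
  field
    ballot   : ∀ {i} → i ≤ m → closers W i ≤ openers W i
    balanced : openers W m ≡ closers W m
    grounded : ∀ {i} → i < m → W i ≡ fixed → openers W i ≡ closers W i

module Matching {m W} (A : IsInvolutionWord m W) where
  open IsInvolutionWord A

  -- The k-th opener is matched with the k-th closer.
  closerMatching openerMatching : ℕ → ℕ → Bool
  closerMatching i j = isCloser (W j) ∧ (closers W j ≡ᵇ openers W i)
  openerMatching i j = isOpener (W j) ∧ (openers W j ≡ᵇ closers W i)

  partnerOf : ArcType → ℕ → ℕ
  partnerOf opener i = least (closerMatching i) m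
  partnerOf fixed  i = i
  partnerOf closer i = least (openerMatching i) m

  match : ℕ → ℕ
  match i = partnerOf (W i) i

  match-fixed : ∀ {i} → W i ≡ fixed → match i ≡ i
  match-fixed e = cong (λ t → partnerOf t _) e

  module _ {i} (e : W i ≡ opener) (i<m : i < m) where

    private
      closers-beyond : openers W i < closers W m
      closers-beyond = <-≤-trans (count-strict (isOpener ∘ W) i<m (cong isOpener e)) (≤-reflexive balanced)

      found : least (closerMatching i) m < m
      found with count-attains (isCloser ∘ W) closers-beyond
      ... | j , j<m , cj , #j = least-< (closerMatching i) j<m (cong₂ _∧_ cj (≡ᵇ-true #j))

      matches : closerMatching i (match i) ≡ true
      matches rewrite e = least-satisfies (closerMatching i) m found

    opener-match-bounded : match i < m
    opener-match-bounded rewrite e = found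

    opener-match-closer : W (match i) ≡ closer
    opener-match-closer = isCloser⁻¹ (∧-conicalˡ _ _ matches)

    opener-match-rank : closers W (match i) ≡ openers W i
    opener-match-rank = ≡ᵇ-true⁻¹ (∧-conicalʳ _ _ matches)

  module _ {i} (e : W i ≡ closer) (i<m : i < m) where

    private
      openers-before : closers W i < openers W i
      openers-before = subst₂ _≤_ (count-suc-true (isCloser ∘ W) (cong isCloser e))
                                  (count-suc-false (isOpener ∘ W) (cong isOpener e)) (ballot i<m)

      found : least (openerMatching i) m < m
      found with count-attains (isOpener ∘ W) openers-before
      ... | j , j<i , oj , #j = least-< (openerMatching i) (<-trans j<i i<m) (cong₂ _∧_ oj (≡ᵇ-true #j))

      matches : openerMatching i (match i) ≡ true
      matches rewrite e = least-satisfies (openerMatching i) m found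

    closer-match-opener : W (match i) ≡ opener
    closer-match-opener = isOpener⁻¹ (∧-conicalˡ _ _ matches)

    closer-match-rank : openers W (match i) ≡ closers W i
    closer-match-rank = ≡ᵇ-true⁻¹ (∧-conicalʳ _ _ matches)

    closer-match-< : match i < i
    closer-match-< = count-<⇒< (isOpener ∘ W) (subst (_< openers W i) (sym closer-match-rank) openers-before)

  opener-match-> : ∀ {i} → W i ≡ opener → i < m → i < match i
  opener-match-> {i} e i<m with i <? match i
  ... | yes i<j = i<j
  ... | no i≮j  = ⊥-elim (<⇒≱ too-many-closers (ballot (<⇒≤ i<m)))
    where
    -- the partner, a closer at or before i, already brings the closers up to openers W i + 1
    too-many-closers : openers W i < closers W i
    too-many-closers = subst₂ _≤_
      (trans (count-suc-true (isCloser ∘ W) (cong isCloser (opener-match-closer e i<m))) (cong suc (opener-match-rank e i<m)))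
      (count-suc-false (isCloser ∘ W) (cong isCloser e))
      (count-mono (isCloser ∘ W) (s≤s (≮⇒≥ i≮j)))

  match-bounded : ∀ {i} → i < m → match i < m
  match-bounded {i} i<m = arcType-cases (W i)
    (λ e → opener-match-bounded e i<m)
    (λ e → subst (_< m) (sym (match-fixed e)) i<m)
    (λ e → <-trans (closer-match-< e i<m) i<m)

  arcType-match : ∀ {i} → i < m → arcType i (match i) ≡ W i
  arcType-match {i} i<m = arcType-cases (W i)
    (λ e → trans (arcType-opener (opener-match-> e i<m)) (sym e))
    (λ e → trans (arcType-fixed (sym (match-fixed e))) (sym e))
    (λ e → trans (arcType-closer (closer-match-< e i<m)) (sym e))

  match-involutive : ∀ {i} → i < m → match (match i) ≡ i
  match-involutive {i} i<m = arcType-cases (W i) via-opener via-fixed via-closer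
    where
    via-opener : W i ≡ opener → match (match i) ≡ i
    via-opener e = count-injective (isOpener ∘ W) (cong isOpener (closer-match-opener e′ j<m)) (cong isOpener e)
                                   (trans (closer-match-rank e′ j<m) (opener-match-rank e i<m))
      where
      e′  = opener-match-closer e i<m
      j<m = opener-match-bounded e i<m
    via-fixed : W i ≡ fixed → match (match i) ≡ i
    via-fixed e = trans (cong match (match-fixed e)) (match-fixed e)
    via-closer : W i ≡ closer → match (match i) ≡ i
    via-closer e = count-injective (isCloser ∘ W) (cong isCloser (opener-match-closer e′ j<m)) (cong isCloser e)
                                   (trans (opener-match-rank e′ j<m) (closer-match-rank e i<m))
      where
      e′  = closer-match-opener e i<m
      j<m = <-trans (closer-match-< e i<m) i<m

  opener-match-mono : ∀ {a b} → a < b → b < m → W a ≡ opener → W b ≡ opener → match a < match b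
  opener-match-mono a<b b<m ea eb = count-<⇒< (isCloser ∘ W)
    (subst₂ _<_ (sym (opener-match-rank ea (<-trans a<b b<m))) (sym (opener-match-rank eb b<m))
                (count-strict (isOpener ∘ W) a<b (cong isOpener ea)))

  closer-match-mono : ∀ {a b} → a < b → b < m → W a ≡ closer → W b ≡ closer → match a < match b
  closer-match-mono a<b b<m ea eb = count-<⇒< (isOpener ∘ W)
    (subst₂ _<_ (sym (closer-match-rank ea (<-trans a<b b<m))) (sym (closer-match-rank eb b<m))
                (count-strict (isCloser ∘ W) a<b (cong isCloser ea)))

  match-avoids321 : ∀ {a b c} → a < b → b < c → c < m → match b < match a → match c < match b → ⊥
  match-avoids321 {a} {b} {c} a<b b<c c<m mb<ma mc<mb = arcType-cases (W b) via-opener via-fixed via-closer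
    where
    b<m = <-trans b<c c<m
    a<m = <-trans a<b b<m
    opener-at : ∀ {i} → i < m → i < match i → W i ≡ opener
    opener-at i<m lt = trans (sym (arcType-match i<m)) (arcType-opener lt)
    via-opener : W b ≡ opener → ⊥
    via-opener e = <-asym mb<ma (opener-match-mono a<b b<m (opener-at a<m a<ma) e)
      where a<ma = <-trans a<b (<-trans (opener-match-> e b<m) mb<ma)
    via-closer : W b ≡ closer → ⊥
    via-closer e = <-asym mc<mb (closer-match-mono b<c c<m e (trans (sym (arcType-match c<m)) (arcType-closer mc<c)))
      where mc<c = <-trans mc<mb (<-trans (closer-match-< e b<m) b<c)
    -- b would be a fixed point under the arc (a, match a), above level zero
    via-fixed : W b ≡ fixed → ⊥
    via-fixed e = <-irrefl refl (≤-trans more-openers (≤-trans (≤-reflexive (grounded b<m e)) fewer-closers))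
      where
      b<ma = subst (_< match a) (match-fixed e) mb<ma
      ea = opener-at a<m (<-trans a<b b<ma)
      more-openers : suc (openers W a) ≤ openers W b
      more-openers = subst (_≤ openers W b) (count-suc-true (isOpener ∘ W) (cong isOpener ea))
                           (count-mono (isOpener ∘ W) a<b)
      fewer-closers : closers W b ≤ openers W a
      fewer-closers = subst (closers W b ≤_) (opener-match-rank ea a<m) (count-mono (isCloser ∘ W) (<⇒≤ b<ma))

  match-is321AvoidingInvolution : Is321AvoidingInvolution m match
  match-is321AvoidingInvolution = record
    { bounded = match-bounded ; involutive = match-involutive ; avoids321 = match-avoids321 }

  module _ (antisym : IsAntisymmetric m W) where

    -- Counting openers and closers on both sides of the reflected arc shows that the mirror
    -- image of the closer matched with i is the opener matched with the mirror image of i.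
    opener-match-centrosymmetric : ∀ {i} j → W i ≡ opener → suc (i + j) ≡ m → suc (match i + match j) ≡ m
    opener-match-centrosymmetric {i} j e i+j = subst (λ z → suc (k + z) ≡ m) (sym mj≡k′) k+k′
      where
      i<m = complement-< i j i+j
      j<m = complement-< j i (complement-sym i j i+j)
      k = match i
      k′ = m ∸ suc k
      k+k′ : suc (k + k′) ≡ m
      k+k′ = m+[n∸m]≡n (opener-match-bounded e i<m)
      ek′ : W k′ ≡ opener
      ek′ = trans (antisym k k′ k+k′) (cong mirror (opener-match-closer e i<m))
      ej : W j ≡ closer
      ej = trans (antisym i j i+j) (cong mirror e)
      openers-total : openers W m ≡ suc (openers W i) + closers W j
      openers-total = trans (openers-antisymmetric antisym (suc i) j i+j)
                            (cong (_+ closers W j) (count-suc-true (isOpener ∘ W) (cong isOpener e)))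
      closers-total : closers W m ≡ suc (openers W i) + openers W k′
      closers-total = trans (closers-antisymmetric antisym (suc k) k′ k+k′)
        (cong (_+ openers W k′) (trans (count-suc-true (isCloser ∘ W) (cong isCloser (opener-match-closer e i<m)))
                                       (cong suc (opener-match-rank e i<m))))
      closers-j : closers W j ≡ openers W k′
      closers-j = +-cancelˡ-≡ (suc (openers W i)) _ _ (trans (sym openers-total) (trans balanced closers-total))
      mj≡k′ : match j ≡ k′
      mj≡k′ = count-injective (isOpener ∘ W) (cong isOpener (closer-match-opener ej j<m)) (cong isOpener ek′)
                              (trans (closer-match-rank ej j<m) closers-j)

    match-centrosymmetric : IsCentrosymmetricOn m match
    match-centrosymmetric i j i+j = arcType-cases (W i) via-opener via-fixed via-closer
      where
      mirrored : ∀ {t} → W i ≡ t → W j ≡ mirror t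
      mirrored e = trans (antisym i j i+j) (cong mirror e)
      via-opener : W i ≡ opener → suc (match i + match j) ≡ m
      via-opener e = opener-match-centrosymmetric j e i+j
      via-fixed : W i ≡ fixed → suc (match i + match j) ≡ m
      via-fixed e = trans (cong₂ (λ a b → suc (a + b)) (match-fixed e) (match-fixed (mirrored e))) i+j
      via-closer : W i ≡ closer → suc (match i + match j) ≡ m
      via-closer e = trans (cong suc (+-comm (match i) (match j)))
                           (opener-match-centrosymmetric i (mirrored e) (complement-sym i j i+j))

step-balance : ∀ b h x → x + h + iverson (isOpener (stepType b h)) ≡
                         x + iverson (isCloser (stepType b h)) + (if b then suc h else pred h)
step-balance true  h       x = up x h
  where up : ∀ x h → x + h + 1 ≡ x + 0 + suc h
        up = solve-∀
step-balance false zero    x = refl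
step-balance false (suc h) x = down x h
  where down : ∀ x h → x + suc h + 0 ≡ x + 1 + h
        down = solve-∀

openers-pathType : ∀ β i → openers (pathType β) i ≡ closers (pathType β) i + height β i
openers-pathType β zero    = refl
openers-pathType β (suc i) = begin
  openers (pathType β) i + iverson (isOpener (pathType β i))
    ≡⟨ cong (_+ iverson (isOpener (pathType β i))) (openers-pathType β i) ⟩
  closers (pathType β) i + height β i + iverson (isOpener (pathType β i))
    ≡⟨ step-balance (β i) (height β i) _ ⟩
  closers (pathType β) i + iverson (isCloser (pathType β i)) + height β (suc i)
    ∎
  where open ≡-Reasoning

stepType-fixed : ∀ {b h} → stepType b h ≡ fixed → b ≡ false × h ≡ 0
stepType-fixed {false} {zero} _ = refl , refl

codeWord : ℕ → ℕ → (ℕ → Bool) → ℕ → ArcType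
codeWord n m β i = if i <ᵇ n then pathType β i else mirror (pathType β (m ∸ suc i))

module CodeWord {n m} (n+n≡m : n + n ≡ m) (β : ℕ → Bool) where

  W : ℕ → ArcType
  W = codeWord n m β

  first-half : ∀ {i} → i < n → W i ≡ pathType β i
  first-half i<n rewrite <ᵇ-true i<n = refl

  second-half : ∀ {i} → ¬ i < n → W i ≡ mirror (pathType β (m ∸ suc i))
  second-half i≮n rewrite <ᵇ-false i≮n = refl

  complement-∸ : ∀ {i j} → suc (i + j) ≡ m → m ∸ suc j ≡ i
  complement-∸ {i} {j} e = trans (cong (_∸ suc j) (sym e)) (m+n∸n≡m i j)

  not-both-first : ∀ {i j} → suc (i + j) ≡ m → i < n → j < n → ⊥
  not-both-first {i} {j} e i<n j<n =
    n≮n m (subst₂ _≤_ (trans (cong suc (+-suc i j)) (cong suc e)) n+n≡m (+-mono-≤ i<n j<n))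

  not-both-second : ∀ {i j} → suc (i + j) ≡ m → ¬ i < n → ¬ j < n → ⊥
  not-both-second e i≮n j≮n =
    n≮n _ (subst₂ _<_ n+n≡m e (s≤s (+-mono-≤ (≮⇒≥ i≮n) (≮⇒≥ j≮n))))

  antisymmetric : IsAntisymmetric m W
  antisymmetric i j e with i <? n | j <? n
  ... | yes i<n | yes j<n = ⊥-elim (not-both-first e i<n j<n)
  ... | yes i<n | no j≮n  = begin
    W j                                ≡⟨ second-half j≮n ⟩
    mirror (pathType β (m ∸ suc j))    ≡⟨ cong (mirror ∘ pathType β) (complement-∸ e) ⟩
    mirror (pathType β i)              ≡⟨ cong mirror (first-half i<n) ⟨
    mirror (W i)                       ∎
    where open ≡-Reasoning
  ... | no i≮n  | yes j<n = begin
    W j                                ≡⟨ first-half j<n ⟩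
    pathType β j                       ≡⟨ mirror-involutive _ ⟨
    mirror (mirror (pathType β j))     ≡⟨ cong (mirror ∘ mirror ∘ pathType β) (complement-∸ (complement-sym i j e)) ⟨
    mirror (mirror (pathType β (m ∸ suc i))) ≡⟨ cong mirror (second-half i≮n) ⟨
    mirror (W i)                       ∎
    where open ≡-Reasoning
  ... | no i≮n  | no j≮n  = ⊥-elim (not-both-second e i≮n j≮n)

  first-half-count : ∀ P {i} → i ≤ n → count (P ∘ W) i ≡ count (P ∘ pathType β) i
  first-half-count P {i} i≤n = count-cong _ _ i (λ j j<i → cong P (first-half (<-≤-trans j<i i≤n)))

  surplus : ∀ {i} → i ≤ n → openers W i ≡ closers W i + height β i
  surplus {i} i≤n = begin
    openers W i                         ≡⟨ first-half-count isOpener i≤n ⟩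
    openers (pathType β) i              ≡⟨ openers-pathType β i ⟩
    closers (pathType β) i + height β i ≡⟨ cong (_+ height β i) (first-half-count isCloser i≤n) ⟨
    closers W i + height β i            ∎
    where open ≡-Reasoning

  ballot-first-half : ∀ {i} → i ≤ n → closers W i ≤ openers W i
  ballot-first-half {i} i≤n = subst (closers W i ≤_) (sym (surplus i≤n)) (m≤m+n _ _)

  balanced : openers W m ≡ closers W m
  balanced = trans (openers-antisymmetric antisymmetric n n n+n≡m)
                   (trans (+-comm (openers W n) (closers W n)) (sym (closers-antisymmetric antisymmetric n n n+n≡m)))

  exchange : ∀ i k → i + k ≡ m → openers W i + closers W k ≡ closers W i + openers W k
  exchange i k e = trans (sym (openers-antisymmetric antisymmetric i k e))
                         (trans balanced (closers-antisymmetric antisymmetric i k e))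

  complement-≤ : ∀ {i k} → n ≤ i → i + k ≡ m → k ≤ n
  complement-≤ {i} {k} n≤i e =
    +-cancelˡ-≤ n _ _ (subst (n + k ≤_) (sym n+n≡m) (≤-trans (+-monoˡ-≤ k n≤i) (≤-reflexive e)))

  ballot : ∀ {i} → i ≤ m → closers W i ≤ openers W i
  ballot {i} i≤m with i ≤? n
  ... | yes i≤n = ballot-first-half i≤n
  ... | no i≰n  = +-cancelʳ-≤ (openers W k) _ _
                    (subst (_≤ openers W i + openers W k) (exchange i k i+k≡m)
                           (+-monoʳ-≤ (openers W i) (ballot-first-half k≤n)))
    where
    k = m ∸ i
    i+k≡m : i + k ≡ m
    i+k≡m = m+[n∸m]≡n i≤m
    k≤n : k ≤ n
    k≤n = complement-≤ (<⇒≤ (≰⇒> i≰n)) i+k≡m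

  grounded : ∀ {i} → i < m → W i ≡ fixed → openers W i ≡ closers W i
  grounded {i} i<m e with i <? n
  ... | yes i<n = trans (surplus (<⇒≤ i<n)) (trans (cong (closers W i +_) ground) (+-identityʳ _))
    where ground = proj₂ (stepType-fixed (trans (sym (first-half i<n)) e))
  ... | no i≮n  = +-cancelʳ-≡ (closers W k) _ _ (trans (exchange i k i+k≡m) (cong (closers W i +_) level))
    where
    j = m ∸ suc i
    k = suc j
    i+k≡m : i + k ≡ m
    i+k≡m = trans (+-suc i j) (m+[n∸m]≡n i<m)
    fixed-j = stepType-fixed (mirror-fixed (trans (sym (second-half i≮n)) e))
    ground : height β k ≡ 0
    ground = trans (height-down β (proj₁ fixed-j)) (cong pred (proj₂ fixed-j))
    level : openers W k ≡ closers W k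
    level = trans (surplus (complement-≤ (≮⇒≥ i≮n) i+k≡m)) (trans (cong (closers W k +_) ground) (+-identityʳ _))

  isInvolutionWord : IsInvolutionWord m W
  isInvolutionWord = record { ballot = ballot ; balanced = balanced ; grounded = grounded }

isPeak : ArcType → ArcType → Bool
isPeak opener closer = true
isPeak _      _      = false

isPeak⁻¹ : ∀ {s t} → isPeak s t ≡ true → s ≡ opener × t ≡ closer
isPeak⁻¹ {opener} {closer} _ = refl , refl

isPeak-mirror : ∀ s t → isPeak (mirror s) (mirror t) ≡ isPeak t s
isPeak-mirror opener opener = refl
isPeak-mirror opener fixed  = refl
isPeak-mirror opener closer = refl
isPeak-mirror fixed  opener = refl
isPeak-mirror fixed  fixed  = refl
isPeak-mirror fixed  closer = refl
isPeak-mirror closer opener = refl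
isPeak-mirror closer fixed  = refl
isPeak-mirror closer closer = refl

isPeak-turn : ∀ t → isPeak t (mirror t) ≡ isOpener t
isPeak-turn opener = refl
isPeak-turn fixed  = refl
isPeak-turn closer = refl

isOpener-stepType : ∀ b h → isOpener (stepType b h) ≡ b
isOpener-stepType true  _       = refl
isOpener-stepType false zero    = refl
isOpener-stepType false (suc _) = refl

isPeak-step : ∀ b h b′ → isPeak (stepType b h) (stepType b′ (if b then suc h else pred h)) ≡ b ∧ not b′
isPeak-step true  h       true  = refl
isPeak-step true  h       false = refl
isPeak-step false zero    _     = refl
isPeak-step false (suc h) _     = refl

isPeak-pathType : ∀ β i → isPeak (pathType β i) (pathType β (suc i)) ≡ β i ∧ not (β (suc i))
isPeak-pathType β i = isPeak-step (β i) (height β i) (β (suc i))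

drops : (ℕ → Bool) → ℕ → ℕ
drops β = count (λ i → β i ∧ not (β (suc i)))

-- The peaks of the word of β on [0, 2n + 2): the drops 10 of β in the first half, their mirror
-- images in the second, and a peak at the centre when the last bit is 1.
module CodePeaks {n m} (n+n≡m : suc n + suc n ≡ m) (β : ℕ → Bool) where
  open CodeWord {n = suc n} n+n≡m β using (W; first-half; second-half; antisymmetric; complement-∸)

  peak : ℕ → Bool
  peak i = isPeak (W i) (W (suc i))

  peak-first-half : ∀ i → i < n → peak i ≡ β i ∧ not (β (suc i))
  peak-first-half i i<n =
    trans (cong₂ isPeak (first-half (m<n⇒m<1+n i<n)) (first-half (s≤s i<n))) (isPeak-pathType β i)

  peak-centre : peak n ≡ β n
  peak-centre = begin
    isPeak (W n) (W (suc n))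
      ≡⟨ cong₂ isPeak (first-half (n<1+n n)) (second-half (n≮n (suc n))) ⟩
    isPeak (pathType β n) (mirror (pathType β (m ∸ suc (suc n))))
      ≡⟨ cong (λ j → isPeak (pathType β n) (mirror (pathType β j))) (complement-∸ n+n≡m) ⟩
    isPeak (pathType β n) (mirror (pathType β n))
      ≡⟨ isPeak-turn (pathType β n) ⟩
    isOpener (pathType β n)
      ≡⟨ isOpener-stepType (β n) (height β n) ⟩
    β n
      ∎
    where open ≡-Reasoning

  peak-second-half : ∀ i → i < n → peak (n + suc (n ∸ suc i)) ≡ β i ∧ not (β (suc i))
  peak-second-half i i<n = begin
    isPeak (W p) (W (suc p))                   ≡⟨ cong₂ isPeak (antisymmetric (suc i) p 1+i+p) (antisymmetric i (suc p) i+1+p) ⟩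
    isPeak (mirror (W (suc i))) (mirror (W i)) ≡⟨ isPeak-mirror (W (suc i)) (W i) ⟩
    peak i                                     ≡⟨ peak-first-half i i<n ⟩
    β i ∧ not (β (suc i))                      ∎
    where
    open ≡-Reasoning
    p : ℕ
    p = n + suc (n ∸ suc i)
    1+i+p : suc (suc i + p) ≡ m
    1+i+p = trans (rearrange i n (n ∸ suc i)) (trans (cong (λ z → suc n + suc z) (m∸n+n≡m i<n)) n+n≡m)
      where rearrange : ∀ i n d → suc (suc i + (n + suc d)) ≡ suc n + suc (d + suc i)
            rearrange = solve-∀
    i+1+p : suc (i + suc p) ≡ m
    i+1+p = trans (cong suc (+-suc i p)) 1+i+p

  peaks : count peak (m ∸ 1) ≡ 2 * drops β n + iverson (β n)
  peaks = begin
    count peak (m ∸ 1)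
      ≡⟨ cong (λ k → count peak (k ∸ 1)) n+n≡m ⟨
    count peak (n + suc n)
      ≡⟨ count-split peak n (suc n) ⟩
    count peak n + count (λ x → peak (n + x)) (suc n)
      ≡⟨ cong (count peak n +_) (count-front (λ x → peak (n + x)) n) ⟩
    count peak n + (iverson (peak (n + 0)) + count (λ x → peak (n + suc x)) n)
      ≡⟨ cong (λ z → count peak n + (iverson (peak z) + count (λ x → peak (n + suc x)) n)) (+-identityʳ n) ⟩
    count peak n + (iverson (peak n) + count (λ x → peak (n + suc x)) n)
      ≡⟨ cong₂ (λ a b → a + (iverson (peak n) + b)) (count-cong _ _ n peak-first-half)
                                                     (count-reverse (λ x → peak (n + suc x)) n) ⟩
    drops β n + (iverson (peak n) + count (λ x → peak (n + suc (n ∸ suc x))) n)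
      ≡⟨ cong₂ (λ a b → drops β n + (iverson a + b)) peak-centre (count-cong _ _ n peak-second-half) ⟩
    drops β n + (iverson (β n) + drops β n)
      ≡⟨ rearrange (drops β n) (iverson (β n)) ⟩
    2 * drops β n + iverson (β n)
      ∎
    where
    open ≡-Reasoning
    rearrange : ∀ a b → a + (b + a) ≡ 2 * a + b
    rearrange = solve-∀

words : ∀ {a} {A : Set a} → List A → (n : ℕ) → List (Vec A n)
words xs zero    = [ [] ]
words xs (suc n) = concatMap (λ x → List.map (x ∷_) (words xs n)) xs

∈-words : ∀ {a} {A : Set a} {xs : List A} → (∀ x → x ∈ xs) → ∀ {n} (v : Vec A n) → v ∈ words xs n
∈-words ∈xs []      = here refl
∈-words ∈xs (x ∷ v) = ∈-concat⁺′ (∈-map⁺ (x ∷_) (∈-words ∈xs v)) (∈-map⁺ _ (∈xs x))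

words-unique : ∀ {a} {A : Set a} {xs : List A} → Unique xs → ∀ n → Unique (words xs n)
words-unique xs! zero    = All.[] ∷ []
words-unique xs! (suc n) =
  concat⁺ (All-map⁺ (All.universal (λ x → Unique-map⁺ ∷-injectiveʳ (words-unique xs! n)) _))
          (AllPairs-map⁺ (AllPairs.map disjoint xs!))
  where
  disjoint : ∀ {x y} → x ≢ y → Disjoint (List.map (x ∷_) (words _ n)) (List.map (y ∷_) (words _ n))
  disjoint x≢y (p , q) with ∈-map⁻ _ p | ∈-map⁻ _ q
  ... | _ , _ , refl | _ , _ , e = x≢y (∷-injectiveˡ e)

allVecs≡words : ∀ k m → allVecs k m ≡ words (List.allFin k) m
allVecs≡words k zero    = refl
allVecs≡words k (suc m) =
  cong (λ ws → concatMap (λ x → List.map (x ∷_) ws) (List.allFin k)) (allVecs≡words k m)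

codes : (n : ℕ) → List (Vec Bool n)
codes = words (false ∷ true ∷ [])

∈-allVecs : ∀ {k m} (v : Vec (Fin k) m) → v ∈ allVecs k m
∈-allVecs {k} {m} v = subst (v ∈_) (sym (allVecs≡words k m)) (∈-words ∈-allFin v)

allVecs-unique : ∀ k m → Unique (allVecs k m)
allVecs-unique k m = subst Unique (sym (allVecs≡words k m)) (words-unique (Unique-allFin⁺ k) m)

∈-codes : ∀ {n} (c : Vec Bool n) → c ∈ codes n
∈-codes = ∈-words λ { false → here refl ; true → there (here refl) }

codes-unique : ∀ n → Unique (codes n)
codes-unique = words-unique (((λ ()) All.∷ All.[]) ∷ All.[] ∷ [])

-- A code is stored last bit first: x ∷ c has the bits of c on [0, n) and x at n.
bits : ∀ {n} → Vec Bool n → ℕ → Bool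
bits []            i = false
bits {suc n} (x ∷ c) i = if i ≡ᵇ n then x else bits c i

lastBit : ∀ {n} → Vec Bool n → Bool
lastBit []      = false
lastBit (x ∷ _) = x

bits-below : ∀ {n} x (c : Vec Bool n) {i} → i < n → bits (x ∷ c) i ≡ bits c i
bits-below x c {i} i<n = cong (λ b → if b then x else bits c i) (≡ᵇ-false (<⇒≢ i<n))

bits-top : ∀ {n} x (c : Vec Bool n) → bits (x ∷ c) n ≡ x
bits-top {n} x c = cong (λ b → if b then x else bits c n) (≡ᵇ-true (refl {x = n}))

-- By des-toMap below, the descent number of the involution encoded by c.
codeDes : ∀ {n} → Vec Bool n → ℕ
codeDes {n} c = 2 * drops (bits c) (pred n) + iverson (lastBit c)

drops-extend : ∀ {n} x (c : Vec Bool n) →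
               drops (bits (x ∷ c)) n ≡ drops (bits c) (pred n) + iverson (lastBit c ∧ not x)
drops-extend x []            = refl
drops-extend {suc n} x (y ∷ c) = cong₂ _+_ (count-cong _ _ n below) (cong iverson (cong₂ drop at-n at-1+n))
  where
  drop : Bool → Bool → Bool
  drop a b = a ∧ not b
  below : ∀ i → i < n → drop (bits (x ∷ y ∷ c) i) (bits (x ∷ y ∷ c) (suc i)) ≡ drop (bits (y ∷ c) i) (bits (y ∷ c) (suc i))
  below i i<n = cong₂ drop (bits-below x (y ∷ c) (m<n⇒m<1+n i<n)) (bits-below x (y ∷ c) (s≤s i<n))
  at-n : bits (x ∷ y ∷ c) n ≡ y
  at-n = trans (bits-below x (y ∷ c) (n<1+n n)) (bits-top y c)
  at-1+n : bits (x ∷ y ∷ c) (suc n) ≡ x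
  at-1+n = bits-top x (y ∷ c)

-- Appending a bit raises codeDes by 1 for exactly one of the two choices.
codeDes-false : ∀ {n} (c : Vec Bool n) →
                codeDes (false ∷ c) ≡ (if lastBit c then suc (codeDes c) else codeDes c)
codeDes-false {n} c rewrite drops-extend false c with lastBit c
... | true  = arith (drops (bits c) (pred n))
  where arith : ∀ p → 2 * (p + 1) + 0 ≡ suc (2 * p + 1)
        arith = solve-∀
... | false = arith (drops (bits c) (pred n))
  where arith : ∀ p → 2 * (p + 0) + 0 ≡ 2 * p + 0
        arith = solve-∀

codeDes-true : ∀ {n} (c : Vec Bool n) →
               codeDes (true ∷ c) ≡ (if lastBit c then codeDes c else suc (codeDes c))
codeDes-true {n} c rewrite drops-extend true c with lastBit c
... | true  = arith (drops (bits c) (pred n))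
  where arith : ∀ p → 2 * (p + 0) + 1 ≡ 2 * p + 1
        arith = solve-∀
... | false = arith (drops (bits c) (pred n))
  where arith : ∀ p → 2 * (p + 0) + 1 ≡ suc (2 * p + 0)
        arith = solve-∀

module CodeSum {c ℓ} (R : CommutativeSemiring c ℓ) (q : CommutativeSemiring.Carrier R) where
  open CommutativeSemiring R
    using (Carrier; _≈_; 0#; 1#; rawSemiring; setoid; +-congˡ; +-congʳ; *-congˡ; distribʳ)
    renaming ( trans to ≈-trans; _+_ to _⊕_; _*_ to _⊛_
             ; +-comm to ⊕-comm; +-identityʳ to ⊕-identityʳ; *-identityˡ to ⊛-identityˡ)
  open import Algebra.Definitions.RawSemiring rawSemiring using (_^_)
  open import Relation.Binary.Reasoning.Setoid setoid
  open ListSum R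

  one-more : ∀ a → q ^ a ⊕ q ^ suc a ≈ (1# ⊕ q) ⊛ q ^ a
  one-more a = begin
    q ^ a ⊕ q ⊛ q ^ a        ≈⟨ +-congʳ (⊛-identityˡ _) ⟨
    1# ⊛ q ^ a ⊕ q ⊛ q ^ a   ≈⟨ distribʳ _ _ _ ⟨
    (1# ⊕ q) ⊛ q ^ a         ∎

  one-more-either : ∀ b a {x y} → x ≡ (if b then suc a else a) → y ≡ (if b then a else suc a) →
                    q ^ x ⊕ q ^ y ≈ (1# ⊕ q) ⊛ q ^ a
  one-more-either true  a refl refl = ≈-trans (⊕-comm _ _) (one-more a)
  one-more-either false a refl refl = one-more a

  children-sum : ∀ {n} (c : Vec Bool n) →
                 q ^ codeDes (false ∷ c) ⊕ q ^ codeDes (true ∷ c) ≈ (1# ⊕ q) ⊛ q ^ codeDes c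
  children-sum c = one-more-either (lastBit c) (codeDes c) (codeDes-false c) (codeDes-true c)

  sum-codes : ∀ n → sumOver (λ c → q ^ codeDes c) (codes n) ≈ (1# ⊕ q) ^ n
  sum-codes zero    = ⊕-identityʳ _
  sum-codes (suc n) = begin
    sumOver w (codes (suc n))
      ≈⟨ sumOver-concatMap w with-last (false ∷ true ∷ []) ⟩
    sumOver w (with-last false) ⊕ (sumOver w (with-last true) ⊕ 0#)
      ≈⟨ +-congˡ (⊕-identityʳ _) ⟩
    sumOver w (with-last false) ⊕ sumOver w (with-last true)
      ≡⟨ cong₂ _⊕_ (sumOver-map w (false ∷_) (codes n)) (sumOver-map w (true ∷_) (codes n)) ⟩
    sumOver (λ c → w (false ∷ c)) (codes n) ⊕ sumOver (λ c → w (true ∷ c)) (codes n)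
      ≈⟨ sumOver-+ (λ c → w (false ∷ c)) (λ c → w (true ∷ c)) (codes n) ⟩
    sumOver (λ c → w (false ∷ c) ⊕ w (true ∷ c)) (codes n)
      ≈⟨ sumOver-cong children-sum (codes n) ⟩
    sumOver (λ c → (1# ⊕ q) ⊛ w c) (codes n)
      ≈⟨ sumOver-*ˡ (1# ⊕ q) w (codes n) ⟩
    (1# ⊕ q) ⊛ sumOver w (codes n)
      ≈⟨ *-congˡ (sum-codes n) ⟩
    (1# ⊕ q) ⊛ (1# ⊕ q) ^ n
      ∎
    where
    w : ∀ {k} → Vec Bool k → Carrier
    w c = q ^ codeDes c
    with-last : Bool → List (Vec Bool (suc n))
    with-last x = List.map (x ∷_) (codes n)

at : List ℕ → ℕ → ℕ
at []       _       = 0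
at (x ∷ xs) zero    = x
at (x ∷ xs) (suc i) = at xs i

asFunction : ∀ {m k} → Vec (Fin m) k → ℕ → ℕ
asFunction π = at (toList (Vec.map toℕ π))

asFunction-lookup : ∀ {m k} (π : Vec (Fin m) k) (i : Fin k) → asFunction π (toℕ i) ≡ toℕ (lookup π i)
asFunction-lookup (x ∷ π) Fin.zero    = refl
asFunction-lookup (x ∷ π) (Fin.suc i) = asFunction-lookup π i

asFunction-fromℕ< : ∀ {m k} (π : Vec (Fin m) k) {i} (i<k : i < k) →
                    asFunction π i ≡ toℕ (lookup π (fromℕ< i<k))
asFunction-fromℕ< π i<k = trans (cong (asFunction π) (sym (toℕ-fromℕ< i<k))) (asFunction-lookup π _)

module _ {m} (π : Map m) where
  private
    f : ℕ → ℕ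
    f = asFunction π

    at-fromℕ< : ∀ {i} (i<m : i < m) → f i ≡ toℕ (lookup π (fromℕ< i<m))
    at-fromℕ< = asFunction-fromℕ< π

  InIC321⇒is321AvoidingInvolution : InIC321 π → Is321AvoidingInvolution m f
  InIC321⇒is321AvoidingInvolution (_ , involution , _ , avoids) =
    record { bounded = bounded ; involutive = involutive ; avoids321 = avoids321 }
    where
    bounded : ∀ {i} → i < m → f i < m
    bounded i<m = subst (_< m) (sym (at-fromℕ< i<m)) (toℕ<n _)
    involutive : ∀ {i} → i < m → f (f i) ≡ i
    involutive i<m = trans (cong f (at-fromℕ< i<m))
                           (trans (asFunction-lookup π _) (trans (cong toℕ (involution _)) (toℕ-fromℕ< i<m)))
    avoids321 : ∀ {a b c} → a < b → b < c → c < m → f b < f a → f c < f b → ⊥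
    avoids321 {a} {b} {c} a<b b<c c<m fb<fa fc<fb =
      avoids (fromℕ< a<m , fromℕ< b<m , fromℕ< c<m ,
              subst₂ _<_ (sym (toℕ-fromℕ< a<m)) (sym (toℕ-fromℕ< b<m)) a<b ,
              subst₂ _<_ (sym (toℕ-fromℕ< b<m)) (sym (toℕ-fromℕ< c<m)) b<c ,
              subst₂ _<_ (at-fromℕ< b<m) (at-fromℕ< a<m) fb<fa ,
              subst₂ _<_ (at-fromℕ< c<m) (at-fromℕ< b<m) fc<fb)
      where
      b<m = <-trans b<c c<m
      a<m = <-trans a<b b<m

  InIC321⇒centrosymmetric : InIC321 π → IsCentrosymmetricOn m f
  InIC321⇒centrosymmetric (_ , _ , centro , _) i j i+j = begin
    suc (f i + f j)                                       ≡⟨ cong suc (cong₂ _+_ (at-fromℕ< i<m) f-j) ⟩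
    suc (toℕ (lookup π a) + toℕ (lookup π (opposite a))) ≡⟨ cong suc (centro a) ⟩
    suc (m ∸ 1)                                           ≡⟨ m+[n∸m]≡n (≤-trans (s≤s z≤n) i<m) ⟩
    m                                                     ∎
    where
    open ≡-Reasoning
    i<m = complement-< i j i+j
    a = fromℕ< i<m
    opposite-a : toℕ (opposite a) ≡ j
    opposite-a = begin
      toℕ (opposite a)       ≡⟨ opposite-prop a ⟩
      m ∸ suc (toℕ a)        ≡⟨ cong (λ z → m ∸ suc z) (toℕ-fromℕ< i<m) ⟩
      m ∸ suc i              ≡⟨ cong (_∸ suc i) i+j ⟨
      suc (i + j) ∸ suc i    ≡⟨ m+n∸m≡n (suc i) j ⟩
      j                      ∎
    f-j : f j ≡ toℕ (lookup π (opposite a))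
    f-j = trans (cong f (sym opposite-a)) (asFunction-lookup π _)

module _ {m} (π : Map m) {g : ℕ → ℕ} (π≗g : ∀ {i} → i < m → asFunction π i ≡ g i)
         (G : Is321AvoidingInvolution m g) (centro : IsCentrosymmetricOn m g) where
  open Is321AvoidingInvolution G

  lookup≡ : ∀ i → toℕ (lookup π i) ≡ g (toℕ i)
  lookup≡ i = trans (sym (asFunction-lookup π i)) (π≗g (toℕ<n i))

  ∈IC321 : InIC321 π
  ∈IC321 = isPerm , isInvolution , isCentrosymmetric , avoids
    where
    isPerm : IsPerm π
    isPerm i j e =
      toℕ-injective (injective (toℕ<n i) (toℕ<n j) (trans (sym (lookup≡ i)) (trans (cong toℕ e) (lookup≡ j))))
    isInvolution : IsInvolution π
    isInvolution i = toℕ-injective (trans (lookup≡ (lookup π i)) (trans (cong g (lookup≡ i)) (involutive (toℕ<n i))))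
    isCentrosymmetric : IsCentrosymmetric π
    isCentrosymmetric i =
      trans (cong₂ _+_ (lookup≡ i) (lookup≡ (opposite i))) (cong pred (centro (toℕ i) (toℕ (opposite i)) i+i′))
      where
      i+i′ : suc (toℕ i + toℕ (opposite i)) ≡ m
      i+i′ = trans (cong (λ z → suc (toℕ i + z)) (opposite-prop i)) (m+[n∸m]≡n (toℕ<n i))
    avoids : Avoids321 π
    avoids (i , j , k , i<j , j<k , πj<πi , πk<πj) =
      avoids321 i<j j<k (toℕ<n k) (subst₂ _<_ (lookup≡ j) (lookup≡ i) πj<πi)
                                  (subst₂ _<_ (lookup≡ k) (lookup≡ j) πk<πj)

n+n≡2*n : ∀ n → n + n ≡ 2 * n
n+n≡2*n n = cong (n +_) (sym (+-identityʳ n))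

descents : (ℕ → ℕ) → ℕ → ℕ
descents f = count (λ i → f (suc i) <ᵇ f i)

descentAt≡iverson : ∀ a b → descentAt a b ≡ iverson (b <ᵇ a)
descentAt≡iverson a b with b <? a
... | yes b<a = sym (cong iverson (<ᵇ-true b<a))
... | no b≮a  = sym (cong iverson (<ᵇ-false b≮a))

desFrom≡descents : ∀ a l → desFrom a l ≡ descents (at (a ∷ l)) (List.length l)
desFrom≡descents a []      = refl
desFrom≡descents a (b ∷ l) = trans (cong₂ _+_ (descentAt≡iverson a b) (desFrom≡descents b l))
                                   (sym (count-front (λ i → f (suc i) <ᵇ f i) (List.length l)))
  where f = at (a ∷ b ∷ l)

des≡descents : ∀ {m} (π : Map m) → des π ≡ descents (asFunction π) (m ∸ 1)
des≡descents {zero}  []      = refl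
des≡descents {suc m} (x ∷ π) = trans (desFrom≡descents (toℕ x) (toList (Vec.map toℕ π)))
                                     (cong (descents (asFunction (x ∷ π))) (length-toList (Vec.map toℕ π)))

<∸1⇒suc< : ∀ {i m} → i < m ∸ 1 → suc i < m
<∸1⇒suc< {m = suc m} i<m = s≤s i<m

descent⇔peak : ∀ {m f} → Is321AvoidingInvolution m f → ∀ {i} → suc i < m →
               (f (suc i) <ᵇ f i) ≡ isPeak (arcType i (f i)) (arcType (suc i) (f (suc i)))
descent⇔peak {f = f} F {i} 1+i<m with f (suc i) <? f i
... | yes d = trans (<ᵇ-true d) (sym (cong₂ isPeak (arcType-opener (proj₁ oc)) (arcType-closer (proj₂ oc))))
  where oc = Is321AvoidingInvolution.descent-opener-closer F 1+i<m d
... | no nd with isPeak (arcType i (f i)) (arcType (suc i) (f (suc i))) in e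
...   | true  = ⊥-elim (nd (≤-<-trans (s≤s⁻¹ fsi<si) i<fi))
  where
  i<fi   = arcType-opener⁻¹ (proj₁ (isPeak⁻¹ e))
  fsi<si   = arcType-closer⁻¹ (proj₂ (isPeak⁻¹ e))
...   | false = <ᵇ-false nd

-- The bijection between codes and centrosymmetric 321-avoiding involutions

codeWord-peaks : ∀ n (c : Vec Bool n) →
  count (λ i → isPeak (codeWord n (2 * n) (bits c) i) (codeWord n (2 * n) (bits c) (suc i))) (2 * n ∸ 1) ≡ codeDes c
codeWord-peaks zero    []      = refl
codeWord-peaks (suc n) (x ∷ c) = trans (CodePeaks.peaks (n+n≡2*n (suc n)) (bits (x ∷ c)))
                                       (cong (λ b → 2 * drops (bits (x ∷ c)) n + iverson b) (bits-top x c))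

firstBits : (ℕ → Bool) → (k : ℕ) → Vec Bool k
firstBits β zero    = []
firstBits β (suc k) = β k ∷ firstBits β k

bits-firstBits : ∀ β k {i} → i < k → bits (firstBits β k) i ≡ β i
bits-firstBits β (suc k) {i} i<1+k with i ≟ k
... | yes refl = bits-top (β i) (firstBits β i)
... | no i≢k   = trans (bits-below (β k) (firstBits β k) i<k) (bits-firstBits β k i<k)
  where i<k = ≤∧≢⇒< (s≤s⁻¹ i<1+k) i≢k

firstBits-bits : ∀ {k} β (c : Vec Bool k) → (∀ {i} → i < k → β i ≡ bits c i) → firstBits β k ≡ c
firstBits-bits β []      _ = refl
firstBits-bits β (x ∷ c) h = cong₂ _∷_ (trans (h (n<1+n _)) (bits-top x c))
  (firstBits-bits β c (λ i<k → trans (h (m<n⇒m<1+n i<k)) (bits-below x c i<k)))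

<ᵇ≡isOpener : ∀ i j → (i <ᵇ j) ≡ isOpener (arcType i j)
<ᵇ≡isOpener i j with <-cmp i j
... | tri< i<j _ _ = <ᵇ-true i<j
... | tri≈ i≮j _ _ = <ᵇ-false i≮j
... | tri> i≮j _ _ = <ᵇ-false i≮j

module CodeInvolution (n : ℕ) where

  m : ℕ
  m = 2 * n

  n≤m : n ≤ m
  n≤m = subst (n ≤_) (n+n≡2*n n) (m≤m+n n n)

  module Word (c : Vec Bool n) = CodeWord {n = n} (n+n≡2*n n) (bits c)
  module Match (c : Vec Bool n) = Matching (Word.isInvolutionWord c)

  involution : Vec Bool n → ℕ → ℕ
  involution c = Match.match c

  involution-is321 : ∀ c → Is321AvoidingInvolution m (involution c)
  involution-is321 c = Match.match-is321AvoidingInvolution c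

  toMap : Vec Bool n → Map m
  toMap c = tabulate (λ i → fromℕ< (Is321AvoidingInvolution.bounded (involution-is321 c) (toℕ<n i)))

  asFunction-toMap : ∀ c {i} → i < m → asFunction (toMap c) i ≡ involution c i
  asFunction-toMap c {i} i<m = begin
    asFunction (toMap c) i                  ≡⟨ asFunction-fromℕ< (toMap c) i<m ⟩
    toℕ (lookup (toMap c) (fromℕ< i<m))     ≡⟨ cong toℕ (lookup∘tabulate _ (fromℕ< i<m)) ⟩
    toℕ (fromℕ< _)                          ≡⟨ toℕ-fromℕ< _ ⟩
    involution c (toℕ (fromℕ< i<m))         ≡⟨ cong (involution c) (toℕ-fromℕ< i<m) ⟩
    involution c i                          ∎
    where open ≡-Reasoning

  toMap-∈IC321 : ∀ c → InIC321 (toMap c)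
  toMap-∈IC321 c =
    ∈IC321 (toMap c) (asFunction-toMap c) (involution-is321 c) (Match.match-centrosymmetric c (Word.antisymmetric c))

  des-toMap : ∀ c → des (toMap c) ≡ codeDes c
  des-toMap c = begin
    des (toMap c)                                           ≡⟨ des≡descents (toMap c) ⟩
    descents (asFunction (toMap c)) (m ∸ 1)                 ≡⟨ count-cong _ _ (m ∸ 1) same-descents ⟩
    descents g (m ∸ 1)                                      ≡⟨ count-cong _ _ (m ∸ 1) descent-peak ⟩
    count (λ i → isPeak (arcType i (g i)) (arcType (suc i) (g (suc i)))) (m ∸ 1)
                                                            ≡⟨ count-cong _ _ (m ∸ 1) peak-word ⟩
    count (λ i → isPeak (Word.W c i) (Word.W c (suc i))) (m ∸ 1) ≡⟨ codeWord-peaks n c ⟩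
    codeDes c                                               ∎
    where
    open ≡-Reasoning
    g : ℕ → ℕ
    g = involution c
    same-descents : ∀ i → i < m ∸ 1 → (asFunction (toMap c) (suc i) <ᵇ asFunction (toMap c) i) ≡ (g (suc i) <ᵇ g i)
    same-descents i lt = cong₂ _<ᵇ_ (asFunction-toMap c (<∸1⇒suc< lt)) (asFunction-toMap c (<-trans (n<1+n i) (<∸1⇒suc< lt)))
    descent-peak : ∀ i → i < m ∸ 1 → (g (suc i) <ᵇ g i) ≡ isPeak (arcType i (g i)) (arcType (suc i) (g (suc i)))
    descent-peak i lt = descent⇔peak (involution-is321 c) (<∸1⇒suc< lt)
    peak-word : ∀ i → i < m ∸ 1 → isPeak (arcType i (g i)) (arcType (suc i) (g (suc i))) ≡ isPeak (Word.W c i) (Word.W c (suc i))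
    peak-word i lt = cong₂ isPeak (Match.arcType-match c (<-trans (n<1+n i) (<∸1⇒suc< lt))) (Match.arcType-match c (<∸1⇒suc< lt))

  decode : Map m → Vec Bool n
  decode π = firstBits (openerBits (asFunction π)) n

  decode-toMap : ∀ c → decode (toMap c) ≡ c
  decode-toMap c = firstBits-bits _ c λ {i} i<n → begin
    i <ᵇ asFunction (toMap c) i             ≡⟨ cong (i <ᵇ_) (asFunction-toMap c (<-≤-trans i<n n≤m)) ⟩
    i <ᵇ involution c i                     ≡⟨ <ᵇ≡isOpener i (involution c i) ⟩
    isOpener (arcType i (involution c i))   ≡⟨ cong isOpener (Match.arcType-match c (<-≤-trans i<n n≤m)) ⟩
    isOpener (Word.W c i)                   ≡⟨ cong isOpener (Word.first-half c i<n) ⟩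
    isOpener (pathType (bits c) i)          ≡⟨ isOpener-stepType (bits c i) _ ⟩
    bits c i                                ∎
    where open ≡-Reasoning

  toMap-injective : ∀ {c c′} → toMap c ≡ toMap c′ → c ≡ c′
  toMap-injective {c} {c′} e = trans (sym (decode-toMap c)) (trans (cong decode e) (decode-toMap c′))

  module Decode (π : Map m) (π∈ : InIC321 π) where
    f : ℕ → ℕ
    f = asFunction π

    F : Is321AvoidingInvolution m f
    F = InIC321⇒is321AvoidingInvolution π π∈

    open OpenArcs F using (pathType≡arcType)

    c : Vec Bool n
    c = decode π

    pathType-decode : ∀ {i} → i < n → pathType (bits c) i ≡ arcType i (f i)
    pathType-decode {i} i<n = trans (cong₂ stepType (bits-firstBits _ n i<n)
                                                   (height-cong _ _ i (λ j j<i → bits-firstBits _ n (<-trans j<i i<n))))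
                                    (pathType≡arcType (<-≤-trans i<n n≤m))

    arcType≡word : ∀ {i} → i < m → arcType i (f i) ≡ Word.W c i
    arcType≡word {i} i<m with i <? n
    ... | yes i<n = sym (trans (Word.first-half c i<n) (pathType-decode i<n))
    ... | no i≮n  = trans (arcType-reflect i+j≡m (InIC321⇒centrosymmetric π π∈ i j i+j≡m))
                          (sym (trans (Word.second-half c i≮n) (cong mirror (pathType-decode j<n))))
      where
      j = m ∸ suc i
      i+j≡m : suc (i + j) ≡ m
      i+j≡m = m+[n∸m]≡n i<m
      j<n : j < n
      j<n = Word.complement-≤ c (≮⇒≥ i≮n) (trans (+-suc i j) i+j≡m)

    toMap-decode : toMap c ≡ π
    toMap-decode = begin
      toMap c                     ≡⟨ tabulate∘lookup (toMap c) ⟨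
      tabulate (lookup (toMap c)) ≡⟨ tabulate-cong (λ k → toℕ-injective (sym (agree k))) ⟩
      tabulate (lookup π)         ≡⟨ tabulate∘lookup π ⟩
      π                           ∎
      where
      open ≡-Reasoning
      same : ∀ {i} → i < m → f i ≡ involution c i
      same = arcTypes-injective F (involution-is321 c) (λ i<m → trans (arcType≡word i<m) (sym (Match.arcType-match c i<m)))
      agree : ∀ k → toℕ (lookup π k) ≡ toℕ (lookup (toMap c) k)
      agree k = begin
        toℕ (lookup π k)             ≡⟨ asFunction-lookup π k ⟨
        f (toℕ k)                    ≡⟨ same (toℕ<n k) ⟩
        involution c (toℕ k)         ≡⟨ asFunction-toMap c (toℕ<n k) ⟨
        asFunction (toMap c) (toℕ k) ≡⟨ asFunction-lookup (toMap c) k ⟩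
        toℕ (lookup (toMap c) k)     ∎

  IC321↭codes : IC321 m ↭ List.map toMap (codes n)
  IC321↭codes =
    ∼bag⇒↭ (unique∧set⇒bag IC321-unique (Unique-map⁺ toMap-injective (codes-unique n)) (mk⇔ to from))
    where
    IC321-unique : Unique (IC321 m)
    IC321-unique = Unique-filter⁺ inIC321? (allVecs-unique m m)
    to : ∀ {π} → π ∈ IC321 m → π ∈ List.map toMap (codes n)
    to {π} p = subst (_∈ List.map toMap (codes n)) (Decode.toMap-decode π π∈) (∈-map⁺ toMap (∈-codes (decode π)))
      where π∈ = proj₂ (∈-filter⁻ inIC321? {xs = allVecs m m} p)
    from : ∀ {π} → π ∈ List.map toMap (codes n) → π ∈ IC321 m
    from q with ∈-map⁻ toMap q
    ... | c , _ , refl = ∈-filter⁺ inIC321? {xs = allVecs m m} (∈-allVecs (toMap c)) (toMap-∈IC321 c)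

open import Algebra.Definitions.RawSemiring using (_^_)

theorem3p3 : ∀ {c ℓ : Level} (R : CommutativeSemiring c ℓ) (n : ℕ) → 1 ≤ n →
    (q : CommutativeSemiring.Carrier R) →
    CommutativeSemiring._≈_ R (desGF R (2 * n) q)
    (_^_ (CommutativeSemiring.rawSemiring R) (CommutativeSemiring._+_ R (CommutativeSemiring.1# R) q) n)
theorem3p3 R n _ q = begin
  desGF R (2 * n) q                                ≡⟨ List.foldr-map _⊕_ (q^ ∘ des) 0# (IC321 (2 * n)) ⟨
  sumOver (q^ ∘ des) (IC321 (2 * n))               ≈⟨ sumOver-↭ (q^ ∘ des) IC321↭codes ⟩
  sumOver (q^ ∘ des) (List.map toMap (codes n))    ≡⟨ sumOver-map (q^ ∘ des) toMap (codes n) ⟩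
  sumOver (q^ ∘ des ∘ toMap) (codes n)             ≈⟨ sumOver-cong (reflexive ∘ cong q^ ∘ des-toMap) (codes n) ⟩
  sumOver (q^ ∘ codeDes) (codes n)                 ≈⟨ sum-codes n ⟩
  _^_ rawSemiring (1# ⊕ q) n                       ∎
  where
  open CommutativeSemiring R using (Carrier; 0#; 1#; rawSemiring; setoid; reflexive) renaming (_+_ to _⊕_)
  open import Relation.Binary.Reasoning.Setoid setoid
  open ListSum R
  open CodeSum R q
  open CodeInvolution n
  q^ : ℕ → Carrier
  q^ = _^_ rawSemiring q
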